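{- Let $G$ be a bipartite graph with $n$ vertices, $m$ edges and (nonempty) vertex classes $A,B$. There exists a bipartite graph $R$ on the same vertex set with $m$ edges and the same vertex classes $A,B$ such that (i) $|d_R(u)-d_R(v)|\le 1$ for all $u,v$ belonging to the same vertex class, and (ii) $|E(G)\,\triangle\,E(R)|\le s_2(G)$. In particular, if $m/|A|$ and $m/|B|$ are integers then $R$ is semiregular.
   Context: For a bipartite graph $G$ with vertex classes $A,B$, $|A|=a$, $|B|=b$, and $m$ edges, define $s_2(G)=\sum_{u\in A}\left|d(u)-\frac{m}{a}\right|+\sum_{u\in B}\left|d(u)-\frac{m}{b}\right|$, where $d(u)$ is the degree of $u$. A bipartite graph is semiregular if vertices in the same vertex class have equal degrees. -}

module Defs where

open import Data.Nat using (ℕ; zero; suc; _+_; NonZero; ∣_-_∣; _≤_)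
open import Data.Integer using (+_)
open import Data.Fin using (Fin; zero; suc)
open import Data.Bool using (Bool; true; false; if_then_else_; _xor_)
open import Data.Product using (_×_)
open import Relation.Binary.PropositionalEquality using (_≡_)
import Data.Rational as ℚ
open ℚ using (ℚ)

∑ : (n : ℕ) → (Fin n → ℕ) → ℕ
∑ zero    f = 0
∑ (suc n) f = f zero + ∑ n (λ i → f (suc i))

∑ℚ : (n : ℕ) → (Fin n → ℚ) → ℚ
∑ℚ zero    f = ℚ.0ℚ
∑ℚ (suc n) f = f zero ℚ.+ ∑ℚ n (λ i → f (suc i))

-- A (simple) bipartite graph with vertex classes A = Fin a and B = Fin b:
-- G u v = true iff uv is an edge (u ∈ A, v ∈ B).  Vertex set: A ⊎ B, n = a + b.
BipGraph : ℕ → ℕ → Set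
BipGraph a b = Fin a → Fin b → Bool

indicator : Bool → ℕ
indicator b = if b then 1 else 0

degA : ∀ {a b} → BipGraph a b → Fin a → ℕ
degA {b = b} G u = ∑ b (λ v → indicator (G u v))

degB : ∀ {a b} → BipGraph a b → Fin b → ℕ
degB {a = a} G v = ∑ a (λ u → indicator (G u v))

edges : ∀ {a b} → BipGraph a b → ℕ
edges {a = a} G = ∑ a (degA G)

symDiff : ∀ {a b} → BipGraph a b → BipGraph a b → ℕ
symDiff {a} {b} G R = ∑ a (λ u → ∑ b (λ v → indicator (G u v xor R u v)))

ℕtoℚ : ℕ → ℚ
ℕtoℚ k = + k ℚ./ 1

s₂ : ∀ {a b} .{{_ : NonZero a}} .{{_ : NonZero b}} → BipGraph a b → ℚ
s₂ {a} {b} G =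
  ∑ℚ a (λ u → ℚ.∣ ℕtoℚ (degA G u) ℚ.- (+ edges G ℚ./ a) ∣)
  ℚ.+ ∑ℚ b (λ v → ℚ.∣ ℕtoℚ (degB G v) ℚ.- (+ edges G ℚ./ b) ∣)

Semiregular : ∀ {a b} → BipGraph a b → Set
Semiregular G =
  (∀ u u' → degA G u ≡ degA G u') × (∀ v v' → degB G v ≡ degB G v')

AlmostRegular : ∀ {a b} → BipGraph a b → Set
AlmostRegular G =
  (∀ u u' → ∣ degA G u - degA G u' ∣ ≤ 1) × (∀ v v' → ∣ degB G v - degB G v' ∣ ≤ 1)

{-# OPTIONS --safe #-}
module Submission where

-- Balance the A-side first. Let q = ⌊m/a⌋. While some A-degree lies outside [q, q+1], pick u
-- with d(u) > q and u' with d(u') ≤ q, preferring d(u) ≥ q+2 and d(u') < q when possible, and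
-- replace an edge uv with v not adjacent to u' by u'v. Such a move keeps every B-degree, changes
-- two entries of the adjacency relation and lowers the imbalance
-- max(Σ (d(u) − q − 1)⁺, Σ (q − d(u))⁺) by one, so the total change is at most twice the initial
-- imbalance. As Σ (a·d(u) − m) = 0, its positive and negative parts have equal sums, and they
-- dominate a times the two sums of the imbalance; hence twice the imbalance is at most
-- Σ |d(u) − m/a|. The B-side is then balanced the same way on the transposed graph, which leaves
-- the A-degrees untouched.

open import Defs
import Algebra.Properties.Semiring.Sum as SemiringSum
import Algebra.Properties.CommutativeMonoid.Sum as CommutativeMonoidSum
open import Data.Bool as Bool using (Bool; true; false; _xor_)
open import Data.Bool.Properties using (xor-same)
open import Data.Fin as Fin using (Fin; zero; suc)
import Data.Fin.Properties as Finₚ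
open import Data.Integer as ℤ using (+_; +≤+; _⊖_)
import Data.Integer.Properties as ℤ
open import Data.Nat
open import Data.Nat.Properties
open import Data.Nat.DivMod using (m≡m%n+[m/n]*n; m%n<n; m/n*n≤m; m*[n/m]≡n)
open import Data.Nat.Divisibility using (_∣_)
open import Data.Nat.Solver using (module +-*-Solver)
open import Data.Product using (Σ; ∃; _×_; _,_; proj₁)
open import Data.Rational as ℚ using (ℚ; toℚᵘ)
import Data.Rational.Properties as ℚ
open import Data.Rational.Unnormalised as ℚᵘ using (mkℚᵘ; *≡*; *≤*)
import Data.Rational.Unnormalised.Properties as ℚᵘ
open import Data.Sum using (inj₁; inj₂)
open import Data.Vec.Functional using (transpose)
open import Function using (_∘_; const; flip)
open import Relation.Nullary using (¬_; Dec; yes; no; ¬?; _×-dec_; contradiction)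
open import Relation.Nullary.Decidable using (decidable-stable)
open import Relation.Binary.PropositionalEquality
import Relation.Binary.Reasoning.Setoid as ≈-Reasoning

open +-*-Solver using (solve; _:+_; _:*_; _:=_; con)

module ℕ-Sum = SemiringSum +-*-semiring

∑≡sum : ∀ n (f : Fin n → ℕ) → ∑ n f ≡ ℕ-Sum.sum f
∑≡sum zero    f = refl
∑≡sum (suc n) f = cong (_+_ (f zero)) (∑≡sum n (f ∘ suc))

∑-cong : ∀ n {f g : Fin n → ℕ} → (∀ x → f x ≡ g x) → ∑ n f ≡ ∑ n g
∑-cong zero    f≗g = refl
∑-cong (suc n) f≗g = cong₂ _+_ (f≗g zero) (∑-cong n (f≗g ∘ suc))

∑-mono-≤ : ∀ n {f g : Fin n → ℕ} → (∀ x → f x ≤ g x) → ∑ n f ≤ ∑ n g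
∑-mono-≤ zero    f≤g = z≤n
∑-mono-≤ (suc n) f≤g = +-mono-≤ (f≤g zero) (∑-mono-≤ n (f≤g ∘ suc))

∑-mono-< : ∀ n {f g : Fin n → ℕ} → (∀ x → f x ≤ g x) → ∀ i → f i < g i → ∑ n f < ∑ n g
∑-mono-< (suc n) f≤g zero    fi<gi = +-mono-<-≤ fi<gi (∑-mono-≤ n (f≤g ∘ suc))
∑-mono-< (suc n) f≤g (suc i) fi<gi = +-mono-≤-< (f≤g zero) (∑-mono-< n (f≤g ∘ suc) i fi<gi)

∑-const : ∀ n c → ∑ n (λ _ → c) ≡ n * c
∑-const zero    c = refl
∑-const (suc n) c = cong (_+_ c) (∑-const n c)

∑-zero : ∀ n {f : Fin n → ℕ} → (∀ x → f x ≡ 0) → ∑ n f ≡ 0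
∑-zero n f≗0 = trans (∑-cong n f≗0) (trans (∑-const n 0) (*-zeroʳ n))

∑≡0⇒≡0 : ∀ n (f : Fin n → ℕ) → ∑ n f ≡ 0 → ∀ x → f x ≡ 0
∑≡0⇒≡0 (suc n) f ∑≡0 zero    = m+n≡0⇒m≡0 (f zero) ∑≡0
∑≡0⇒≡0 (suc n) f ∑≡0 (suc x) = ∑≡0⇒≡0 n (f ∘ suc) (m+n≡0⇒n≡0 (f zero) ∑≡0) x

∑≢0⇒∃≢0 : ∀ n (f : Fin n → ℕ) → ∑ n f ≢ 0 → ∃ λ x → f x ≢ 0
∑≢0⇒∃≢0 n f ∑≢0 with Finₚ.any? (λ x → ¬? (f x ≟ 0))
... | yes found = found
... | no  none  = contradiction (∑-zero n (λ x → decidable-stable (f x ≟ 0) (none ∘ (x ,_)))) ∑≢0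

∑-distrib-+ : ∀ n (f g : Fin n → ℕ) → ∑ n (λ x → f x + g x) ≡ ∑ n f + ∑ n g
∑-distrib-+ n f g = begin
  ∑ n (λ x → f x + g x)          ≡⟨ ∑≡sum n _ ⟩
  ℕ-Sum.sum (λ x → f x + g x)    ≡⟨ ℕ-Sum.∑-distrib-+ f g ⟩
  ℕ-Sum.sum f + ℕ-Sum.sum g      ≡⟨ cong₂ _+_ (∑≡sum n f) (∑≡sum n g) ⟨
  ∑ n f + ∑ n g                  ∎
  where open ≡-Reasoning

*-distribˡ-∑ : ∀ n c (f : Fin n → ℕ) → c * ∑ n f ≡ ∑ n (λ x → c * f x)
*-distribˡ-∑ n c f = begin
  c * ∑ n f                  ≡⟨ cong (c *_) (∑≡sum n f) ⟩
  c * ℕ-Sum.sum f            ≡⟨ ℕ-Sum.*-distribˡ-sum c f ⟩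
  ℕ-Sum.sum (λ x → c * f x)  ≡⟨ ∑≡sum n _ ⟨
  ∑ n (λ x → c * f x)        ∎
  where open ≡-Reasoning

∑-comm : ∀ m n (f : Fin m → Fin n → ℕ) → ∑ m (λ x → ∑ n (f x)) ≡ ∑ n (λ y → ∑ m (flip f y))
∑-comm m n f = begin
  ∑ m (λ x → ∑ n (f x))                   ≡⟨ ∑∑≡sum-sum m n f ⟩
  ℕ-Sum.sum (λ x → ℕ-Sum.sum (f x))       ≡⟨ ℕ-Sum.∑-comm f ⟩
  ℕ-Sum.sum (λ y → ℕ-Sum.sum (flip f y))  ≡⟨ ∑∑≡sum-sum n m (flip f) ⟨
  ∑ n (λ y → ∑ m (flip f y))              ∎
  where
  open ≡-Reasoning
  ∑∑≡sum-sum : ∀ m n (f : Fin m → Fin n → ℕ) →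
               ∑ m (λ x → ∑ n (f x)) ≡ ℕ-Sum.sum (λ x → ℕ-Sum.sum (f x))
  ∑∑≡sum-sum m n f = trans (∑≡sum m _) (ℕ-Sum.sum-cong-≗ (λ x → ∑≡sum n (f x)))

∑-agree-except : ∀ n (f g : Fin n → ℕ) i → (∀ x → x ≢ i → f x ≡ g x) → ∑ n f + g i ≡ ∑ n g + f i
∑-agree-except (suc n) f g zero f≗g = begin
  f zero + ∑ n (f ∘ suc) + g zero
    ≡⟨ cong (λ s → f zero + s + g zero) (∑-cong n (λ x → f≗g (suc x) λ ())) ⟩
  f zero + ∑ n (g ∘ suc) + g zero
    ≡⟨ solve 3 (λ x s y → x :+ s :+ y := y :+ s :+ x) refl (f zero) (∑ n (g ∘ suc)) (g zero) ⟩
  g zero + ∑ n (g ∘ suc) + f zero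
    ∎
  where open ≡-Reasoning
∑-agree-except (suc n) f g (suc i) f≗g = begin
  f zero + ∑ n (f ∘ suc) + g (suc i)    ≡⟨ +-assoc (f zero) _ _ ⟩
  f zero + (∑ n (f ∘ suc) + g (suc i))  ≡⟨ cong₂ _+_ (f≗g zero λ ()) (∑-agree-except n _ _ i f≗g-off-i) ⟩
  g zero + (∑ n (g ∘ suc) + f (suc i))  ≡⟨ +-assoc (g zero) _ _ ⟨
  g zero + ∑ n (g ∘ suc) + f (suc i)    ∎
  where
  open ≡-Reasoning
  f≗g-off-i : ∀ x → x ≢ i → f (suc x) ≡ g (suc x)
  f≗g-off-i x x≢i = f≗g (suc x) (x≢i ∘ Finₚ.suc-injective)

∑-single : ∀ n (f : Fin n → ℕ) i → (∀ x → x ≢ i → f x ≡ 0) → ∑ n f ≡ f i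
∑-single n f i f≗0 = +-cancelʳ-≡ 0 _ _ (begin
  ∑ n f + 0               ≡⟨ ∑-agree-except n f (λ _ → 0) i f≗0 ⟩
  ∑ n (λ _ → 0) + f i     ≡⟨ cong (_+ f i) (∑-zero n (λ _ → refl)) ⟩
  f i                     ≡⟨ +-identityʳ (f i) ⟨
  f i + 0                 ∎)
  where open ≡-Reasoning

_[_,_]≔_ : ∀ {a b} → BipGraph a b → Fin a → Fin b → Bool → BipGraph a b
(G [ u , v ]≔ c) x y with x Fin.≟ u | y Fin.≟ v
... | yes _ | yes _ = c
... | _     | _     = G x y

module _ {a b} (G : BipGraph a b) (u : Fin a) (v : Fin b) (c : Bool) where

  ≔-at : (G [ u , v ]≔ c) u v ≡ c
  ≔-at with u Fin.≟ u | v Fin.≟ v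
  ... | yes _   | yes _   = refl
  ... | no  u≢u | _       = contradiction refl u≢u
  ... | yes _   | no  v≢v = contradiction refl v≢v

  ≔-other-row : ∀ x y → x ≢ u → (G [ u , v ]≔ c) x y ≡ G x y
  ≔-other-row x y x≢u with x Fin.≟ u | y Fin.≟ v
  ... | yes x≡u | yes _ = contradiction x≡u x≢u
  ... | yes _   | no  _ = refl
  ... | no  _   | _     = refl

  ≔-other-column : ∀ x y → y ≢ v → (G [ u , v ]≔ c) x y ≡ G x y
  ≔-other-column x y y≢v with x Fin.≟ u | y Fin.≟ v
  ... | yes _ | yes y≡v = contradiction y≡v y≢v
  ... | yes _ | no  _   = refl
  ... | no  _ | _       = refl

  degA-≔ : degA (G [ u , v ]≔ c) u + indicator (G u v) ≡ degA G u + indicator c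
  degA-≔ = trans
    (∑-agree-except b _ _ v (λ y y≢v → cong indicator (≔-other-column u y y≢v)))
    (cong (λ e → degA G u + indicator e) ≔-at)

  degA-≔-other : ∀ x → x ≢ u → degA (G [ u , v ]≔ c) x ≡ degA G x
  degA-≔-other x x≢u = ∑-cong b (λ y → cong indicator (≔-other-row x y x≢u))

  degB-≔ : degB (G [ u , v ]≔ c) v + indicator (G u v) ≡ degB G v + indicator c
  degB-≔ = trans
    (∑-agree-except a _ _ u (λ x x≢u → cong indicator (≔-other-row x v x≢u)))
    (cong (λ e → degB G v + indicator e) ≔-at)

  degB-≔-other : ∀ y → y ≢ v → degB (G [ u , v ]≔ c) y ≡ degB G y
  degB-≔-other y y≢v = ∑-cong a (λ x → cong indicator (≔-other-column x y y≢v))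

indicator-xor-triangle : ∀ p q r → indicator (p xor r) ≤ indicator (p xor q) + indicator (q xor r)
indicator-xor-triangle true  true  r     = ≤-refl
indicator-xor-triangle true  false true  = z≤n
indicator-xor-triangle true  false false = ≤-refl
indicator-xor-triangle false true  true  = ≤-refl
indicator-xor-triangle false false true  = ≤-refl
indicator-xor-triangle false q     false = z≤n

indicator≤1 : ∀ p → indicator p ≤ 1
indicator≤1 true  = ≤-refl
indicator≤1 false = z≤n

symDiff-self : ∀ {a b} (G : BipGraph a b) → symDiff G G ≡ 0
symDiff-self {a} {b} G = ∑-zero a (λ x → ∑-zero b (λ y → cong indicator (xor-same (G x y))))

symDiff-triangle : ∀ {a b} (G H K : BipGraph a b) → symDiff G K ≤ symDiff G H + symDiff H K
symDiff-triangle {a} {b} G H K = begin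
  symDiff G K
    ≤⟨ ∑-mono-≤ a (λ x → ∑-mono-≤ b (λ y → indicator-xor-triangle (G x y) (H x y) (K x y))) ⟩
  ∑ a (λ x → ∑ b (λ y → indicator (G x y xor H x y) + indicator (H x y xor K x y)))
    ≡⟨ ∑-cong a (λ x → ∑-distrib-+ b _ _) ⟩
  ∑ a (λ x → ∑ b (λ y → indicator (G x y xor H x y)) + ∑ b (λ y → indicator (H x y xor K x y)))
    ≡⟨ ∑-distrib-+ a _ _ ⟩
  symDiff G H + symDiff H K
    ∎
  where open ≤-Reasoning

symDiff-≔ : ∀ {a b} (G : BipGraph a b) u v c → symDiff G (G [ u , v ]≔ c) ≤ 1
symDiff-≔ {a} {b} G u v c = begin
  symDiff G H
    ≡⟨ ∑-single a _ u (λ x x≢u → ∑-zero b (λ y → unchanged x y (≔-other-row G u v c x y x≢u))) ⟩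
  ∑ b (λ y → indicator (G u y xor H u y))
    ≡⟨ ∑-single b _ v (λ y y≢v → unchanged u y (≔-other-column G u v c u y y≢v)) ⟩
  indicator (G u v xor H u v)
    ≤⟨ indicator≤1 _ ⟩
  1 ∎
  where
  open ≤-Reasoning
  H = G [ u , v ]≔ c
  unchanged : ∀ x y → H x y ≡ G x y → indicator (G x y xor H x y) ≡ 0
  unchanged x y Hxy≡Gxy =
    trans (cong (λ e → indicator (G x y xor e)) Hxy≡Gxy) (cong indicator (xor-same (G x y)))

symDiff-transpose : ∀ {a b} (G R : BipGraph a b) → symDiff (transpose G) (transpose R) ≡ symDiff G R
symDiff-transpose {a} {b} G R = ∑-comm b a (λ v u → indicator (G u v xor R u v))

edges≡∑degB : ∀ {a b} (G : BipGraph a b) → edges G ≡ ∑ b (degB G)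
edges≡∑degB {a} {b} G = ∑-comm a b (λ u v → indicator (G u v))

edges-cong : ∀ {a b} (R G : BipGraph a b) → (∀ v → degB R v ≡ degB G v) → edges R ≡ edges G
edges-cong {b = b} R G same = trans (edges≡∑degB R) (trans (∑-cong b same) (sym (edges≡∑degB G)))

moveEdge : ∀ {a b} → BipGraph a b → Fin a → Fin a → Fin b → BipGraph a b
moveEdge G u u' v = (G [ u , v ]≔ false) [ u' , v ]≔ true

module _ {a b} (G : BipGraph a b) {u u' : Fin a} {v : Fin b}
         (u≢u' : u ≢ u') (uv∈G : G u v ≡ true) (u'v∉G : G u' v ≡ false) where

  private
    H = G [ u , v ]≔ false
    R = moveEdge G u u' v

    u'v∉H : H u' v ≡ false
    u'v∉H = trans (≔-other-row G u v false u' v (u≢u' ∘ sym)) u'v∉G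

  degB-moveEdge-column : degB R v ≡ degB G v
  degB-moveEdge-column = begin
    degB R v                      ≡⟨ +-identityʳ (degB R v) ⟨
    degB R v + 0                  ≡⟨ cong (λ e → degB R v + indicator e) u'v∉H ⟨
    degB R v + indicator (H u' v) ≡⟨ degB-≔ H u' v true ⟩
    degB H v + 1                  ≡⟨ cong (λ e → degB H v + indicator e) uv∈G ⟨
    degB H v + indicator (G u v)  ≡⟨ degB-≔ G u v false ⟩
    degB G v + 0                  ≡⟨ +-identityʳ (degB G v) ⟩
    degB G v                      ∎
    where open ≡-Reasoning

  degB-moveEdge : ∀ y → degB R y ≡ degB G y
  degB-moveEdge y = by-column (y Fin.≟ v)
    where
    by-column : Dec (y ≡ v) → degB R y ≡ degB G y
    by-column (yes refl) = degB-moveEdge-column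
    by-column (no  y≢v)  = trans (degB-≔-other H u' v true y y≢v) (degB-≔-other G u v false y y≢v)

  degA-moveEdge-source : suc (degA R u) ≡ degA G u
  degA-moveEdge-source = begin
    suc (degA R u)                ≡⟨ +-comm 1 (degA R u) ⟩
    degA R u + 1                  ≡⟨ cong (_+ 1) (degA-≔-other H u' v true u u≢u') ⟩
    degA H u + 1                  ≡⟨ cong (λ e → degA H u + indicator e) uv∈G ⟨
    degA H u + indicator (G u v)  ≡⟨ degA-≔ G u v false ⟩
    degA G u + 0                  ≡⟨ +-identityʳ (degA G u) ⟩
    degA G u                      ∎
    where open ≡-Reasoning

  degA-moveEdge-target : degA R u' ≡ suc (degA G u')
  degA-moveEdge-target = begin
    degA R u'                       ≡⟨ +-identityʳ (degA R u') ⟨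
    degA R u' + 0                   ≡⟨ cong (λ e → degA R u' + indicator e) u'v∉H ⟨
    degA R u' + indicator (H u' v)  ≡⟨ degA-≔ H u' v true ⟩
    degA H u' + 1                   ≡⟨ cong (_+ 1) (degA-≔-other G u v false u' (u≢u' ∘ sym)) ⟩
    degA G u' + 1                   ≡⟨ +-comm (degA G u') 1 ⟩
    suc (degA G u')                 ∎
    where open ≡-Reasoning

  degA-moveEdge-other : ∀ x → x ≢ u → x ≢ u' → degA R x ≡ degA G x
  degA-moveEdge-other x x≢u x≢u' =
    trans (degA-≔-other H u' v true x x≢u') (degA-≔-other G u v false x x≢u)

  symDiff-moveEdge : symDiff G R ≤ 2
  symDiff-moveEdge =
    ≤-trans (symDiff-triangle G H R) (+-mono-≤ (symDiff-≔ G u v false) (symDiff-≔ H u' v true))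

indicator-≤ : ∀ p q → ¬ (p ≡ true × q ≡ false) → indicator p ≤ indicator q
indicator-≤ true  true  _  = ≤-refl
indicator-≤ true  false ¬p = contradiction (refl , refl) ¬p
indicator-≤ false q     _  = z≤n

degA<⇒private-neighbour : ∀ {a b} (G : BipGraph a b) {u u'} → degA G u' < degA G u →
                          ∃ λ v → G u v ≡ true × G u' v ≡ false
degA<⇒private-neighbour {b = b} G {u} {u'} deg<
  with Finₚ.any? (λ v → G u v Bool.≟ true ×-dec G u' v Bool.≟ false)
... | yes found = found
... | no  none  =
  contradiction (∑-mono-≤ b (λ v → indicator-≤ (G u v) (G u' v) (none ∘ (v ,_)))) (<⇒≱ deg<)

excess deficit imbalance : ∀ {n} → ℕ → (Fin n → ℕ) → ℕ
excess  {n} q D = ∑ n (λ x → D x ∸ suc q)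
deficit {n} q D = ∑ n (λ x → q ∸ D x)
imbalance q D = excess q D ⊔ deficit q D

imbalance≡0⇒within : ∀ {n} q (D : Fin n → ℕ) → imbalance q D ≡ 0 → ∀ x → q ≤ D x × D x ≤ suc q
imbalance≡0⇒within {n} q D Φ≡0 x =
  m∸n≡0⇒m≤n (∑≡0⇒≡0 n _ (n≤0⇒n≡0 (subst (deficit q D ≤_) Φ≡0 (m≤n⊔m _ _))) x) ,
  m∸n≡0⇒m≤n (∑≡0⇒≡0 n _ (n≤0⇒n≡0 (subst (excess q D ≤_) Φ≡0 (m≤m⊔n _ _))) x)

∃-donor : ∀ {n} q (D : Fin n → ℕ) → n * q ≤ ∑ n D → imbalance q D ≢ 0 →
          ∃ λ u → q < D u × (excess q D ≢ 0 → suc q < D u)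
∃-donor {n} q D n*q≤∑ Φ≢0 with excess q D ≟ 0
... | no excess≢0 =
  let (u , Du∸[1+q]≢0) = ∑≢0⇒∃≢0 n _ excess≢0
      1+q<Du           = m∸n≢0⇒n<m Du∸[1+q]≢0
  in  u , <⇒≤ 1+q<Du , const 1+q<Du
... | yes excess≡0 with Finₚ.any? (λ x → q <? D x)
...   | yes (u , q<Du) = u , q<Du , contradiction excess≡0
...   | no  none       = contradiction n*q≤∑ (<⇒≱ ∑<n*q)
  where
  deficit≢0 : deficit q D ≢ 0
  deficit≢0 = subst (λ e → e ⊔ deficit q D ≢ 0) excess≡0 Φ≢0
  ∑<n*q : ∑ n D < n * q
  ∑<n*q = let (u , q∸Du≢0) = ∑≢0⇒∃≢0 n _ deficit≢0 in
    subst (∑ n D <_) (∑-const n q) (∑-mono-< n (λ x → ≮⇒≥ (none ∘ (x ,_))) u (m∸n≢0⇒n<m q∸Du≢0))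

∃-recipient : ∀ {n} q (D : Fin n → ℕ) → ∑ n D < n * suc q →
              ∃ λ u' → D u' ≤ q × (deficit q D ≢ 0 → D u' < q)
∃-recipient {n} q D ∑<n*[1+q] with deficit q D ≟ 0
... | no deficit≢0 =
  let (u' , q∸Du'≢0) = ∑≢0⇒∃≢0 n _ deficit≢0
      Du'<q          = m∸n≢0⇒n<m q∸Du'≢0
  in  u' , <⇒≤ Du'<q , const Du'<q
... | yes deficit≡0 with Finₚ.any? (λ x → D x ≤? q)
...   | yes (u' , Du'≤q) = u' , Du'≤q , contradiction deficit≡0
...   | no  none         = contradiction ∑<n*[1+q] (≤⇒≯ n*[1+q]≤∑)
  where
  n*[1+q]≤∑ : n * suc q ≤ ∑ n D
  n*[1+q]≤∑ = subst (_≤ ∑ n D) (∑-const n (suc q)) (∑-mono-≤ n (λ x → ≰⇒> (none ∘ (x ,_))))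

⊔-mono-<-nonzero : ∀ {m n m' n'} → m' ≤ m → n' ≤ n → (m ≢ 0 → m' < m) → (n ≢ 0 → n' < n) →
                   m ⊔ n ≢ 0 → m' ⊔ n' < m ⊔ n
⊔-mono-<-nonzero {m} {n} m'≤m n'≤n m'<m n'<n m⊔n≢0 =
  ⊔-lub (below m'≤m m'<m (m≤m⊔n m n)) (below n'≤n n'<n (m≤n⊔m m n))
  where
  below : ∀ {k k'} → k' ≤ k → (k ≢ 0 → k' < k) → k ≤ m ⊔ n → k' < m ⊔ n
  below {zero}  z≤n _    _       = n≢0⇒n>0 m⊔n≢0
  below {suc k} _   k'<k k≤m⊔n = <-≤-trans (k'<k λ ()) k≤m⊔n

module _ {n} (q : ℕ) (D D' : Fin n → ℕ) {u u' : Fin n}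
         (source : suc (D' u) ≡ D u) (target : D' u' ≡ suc (D u'))
         (others : ∀ x → x ≢ u → x ≢ u' → D' x ≡ D x)
         (q<Du : q < D u) (Du'≤q : D u' ≤ q) where

  private
    D'u<Du : D' u < D u
    D'u<Du = ≤-reflexive source

    q≤D'u : q ≤ D' u
    q≤D'u = ≤-pred (≤-trans q<Du (≤-reflexive (sym source)))

    D'u'≤1+q : D' u' ≤ suc q
    D'u'≤1+q = ≤-trans (≤-reflexive target) (s≤s Du'≤q)

    Du'<D'u' : D u' < D' u'
    Du'<D'u' = ≤-reflexive (sym target)

    excess-term-≤ : ∀ x → D' x ∸ suc q ≤ D x ∸ suc q
    excess-term-≤ x with x Fin.≟ u | x Fin.≟ u'
    ... | yes refl | _        = ∸-monoˡ-≤ (suc q) (<⇒≤ D'u<Du)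
    ... | no _     | yes refl = ≤-trans (≤-reflexive (m≤n⇒m∸n≡0 D'u'≤1+q)) z≤n
    ... | no x≢u   | no x≢u'  = ≤-reflexive (cong (_∸ suc q) (others x x≢u x≢u'))

    deficit-term-≤ : ∀ x → q ∸ D' x ≤ q ∸ D x
    deficit-term-≤ x with x Fin.≟ u | x Fin.≟ u'
    ... | yes refl | _        = ≤-trans (≤-reflexive (m≤n⇒m∸n≡0 q≤D'u)) z≤n
    ... | no _     | yes refl = ∸-monoʳ-≤ q (<⇒≤ Du'<D'u')
    ... | no x≢u   | no x≢u'  = ≤-reflexive (cong (q ∸_) (others x x≢u x≢u'))

  imbalance-transfer-< : (excess q D ≢ 0 → suc q < D u) → (deficit q D ≢ 0 → D u' < q) →
                         imbalance q D ≢ 0 → imbalance q D' < imbalance q D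
  imbalance-transfer-< big-donor small-recipient =
    ⊔-mono-<-nonzero (∑-mono-≤ n excess-term-≤) (∑-mono-≤ n deficit-term-≤)
      (λ excess≢0 → ∑-mono-< n excess-term-≤ u
         (∸-monoˡ-< D'u<Du (≤-pred (≤-trans (big-donor excess≢0) (≤-reflexive (sym source))))))
      (λ deficit≢0 → ∑-mono-< n deficit-term-≤ u'
         (∸-monoʳ-< Du'<D'u' (≤-trans (≤-reflexive target) (small-recipient deficit≢0))))

∣m-n∣≡[m∸n]+[n∸m] : ∀ m n → ∣ m - n ∣ ≡ (m ∸ n) + (n ∸ m)
∣m-n∣≡[m∸n]+[n∸m] m n with ≤-total m n
... | inj₁ m≤n = trans (m≤n⇒∣m-n∣≡n∸m m≤n) (cong (_+ (n ∸ m)) (sym (m≤n⇒m∸n≡0 m≤n)))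
... | inj₂ n≤m = trans (m≤n⇒∣n-m∣≡n∸m n≤m)
                       (trans (sym (+-identityʳ _)) (cong (_+_ (m ∸ n)) (sym (m≤n⇒m∸n≡0 n≤m))))

m+[n∸m]≡n+[m∸n] : ∀ m n → m + (n ∸ m) ≡ n + (m ∸ n)
m+[n∸m]≡n+[m∸n] m n with ≤-total m n
... | inj₁ m≤n = trans (m+[n∸m]≡n m≤n)
                       (trans (sym (+-identityʳ n)) (cong (_+_ n) (sym (m≤n⇒m∸n≡0 m≤n))))
... | inj₂ n≤m = trans (cong (_+_ m) (m≤n⇒m∸n≡0 n≤m)) (trans (+-identityʳ m) (sym (m+[n∸m]≡n n≤m)))

∑[f∸c]≡∑[c∸f] : ∀ n (f : Fin n → ℕ) c → ∑ n f ≡ n * c → ∑ n (λ x → f x ∸ c) ≡ ∑ n (λ x → c ∸ f x)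
∑[f∸c]≡∑[c∸f] n f c ∑f≡n*c = +-cancelˡ-≡ (n * c) _ _ (begin
  n * c + ∑ n (λ x → f x ∸ c)          ≡⟨ cong (_+ ∑ n (λ x → f x ∸ c)) (∑-const n c) ⟨
  ∑ n (λ _ → c) + ∑ n (λ x → f x ∸ c)  ≡⟨ ∑-distrib-+ n _ _ ⟨
  ∑ n (λ x → c + (f x ∸ c))            ≡⟨ ∑-cong n (λ x → m+[n∸m]≡n+[m∸n] (f x) c) ⟨
  ∑ n (λ x → f x + (c ∸ f x))          ≡⟨ ∑-distrib-+ n _ _ ⟩
  ∑ n f + ∑ n (λ x → c ∸ f x)          ≡⟨ cong (_+ ∑ n (λ x → c ∸ f x)) ∑f≡n*c ⟩
  n * c + ∑ n (λ x → c ∸ f x)          ∎)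
  where open ≡-Reasoning

n*[2*imbalance]≤∑∣n*D-∑D∣ : ∀ {n} q (D : Fin n → ℕ) → n * q ≤ ∑ n D → ∑ n D ≤ n * suc q →
                            n * (2 * imbalance q D) ≤ ∑ n (λ x → ∣ n * D x - ∑ n D ∣)
n*[2*imbalance]≤∑∣n*D-∑D∣ {n} q D n*q≤m m≤n*[1+q] = begin
  n * (2 * imbalance q D)
    ≡⟨ solve 2 (λ n Φ → n :* (con 2 :* Φ) := n :* Φ :+ n :* Φ) refl n (imbalance q D) ⟩
  n * imbalance q D + n * imbalance q D
    ≤⟨ +-mono-≤ n*Φ≤above (subst (n * imbalance q D ≤_) above≡below n*Φ≤above) ⟩
  above + below
    ≡⟨ ∑-distrib-+ n _ _ ⟨
  ∑ n (λ x → (n * D x ∸ m) + (m ∸ n * D x))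
    ≡⟨ ∑-cong n (λ x → ∣m-n∣≡[m∸n]+[n∸m] (n * D x) m) ⟨
  ∑ n (λ x → ∣ n * D x - m ∣)
    ∎
  where
  open ≤-Reasoning
  m = ∑ n D
  above = ∑ n (λ x → n * D x ∸ m)
  below = ∑ n (λ x → m ∸ n * D x)
  above≡below : above ≡ below
  above≡below = ∑[f∸c]≡∑[c∸f] n (λ x → n * D x) m (sym (*-distribˡ-∑ n n D))
  n*excess≤above : n * excess q D ≤ above
  n*excess≤above = begin
    n * excess q D                    ≡⟨ *-distribˡ-∑ n n _ ⟩
    ∑ n (λ x → n * (D x ∸ suc q))     ≡⟨ ∑-cong n (λ x → *-distribˡ-∸ n (D x) (suc q)) ⟩
    ∑ n (λ x → n * D x ∸ n * suc q)   ≤⟨ ∑-mono-≤ n (λ x → ∸-monoʳ-≤ (n * D x) m≤n*[1+q]) ⟩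
    above                             ∎
  n*deficit≤below : n * deficit q D ≤ below
  n*deficit≤below = begin
    n * deficit q D                   ≡⟨ *-distribˡ-∑ n n _ ⟩
    ∑ n (λ x → n * (q ∸ D x))         ≡⟨ ∑-cong n (λ x → *-distribˡ-∸ n q (D x)) ⟩
    ∑ n (λ x → n * q ∸ n * D x)       ≤⟨ ∑-mono-≤ n (λ x → ∸-monoˡ-≤ (n * D x) n*q≤m) ⟩
    below                             ∎
  n*Φ≤above : n * imbalance q D ≤ above
  n*Φ≤above = begin
    n * imbalance q D                     ≡⟨ *-distribˡ-⊔ n (excess q D) (deficit q D) ⟩
    n * excess q D ⊔ n * deficit q D      ≤⟨ ⊔-lub n*excess≤above n*deficit≤above ⟩
    above                                 ∎
    where
    n*deficit≤above : n * deficit q D ≤ above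
    n*deficit≤above = subst (n * deficit q D ≤_) (sym above≡below) n*deficit≤below

within⇒∣-∣≤1 : ∀ {q x y} → q ≤ x × x ≤ suc q → q ≤ y × y ≤ suc q → ∣ x - y ∣ ≤ 1
within⇒∣-∣≤1 {q} {x} {y} (q≤x , x≤1+q) (q≤y , y≤1+q) with ≤-total x y
... | inj₁ x≤y = subst (_≤ 1) (sym (m≤n⇒∣m-n∣≡n∸m x≤y))
                   (≤-trans (∸-mono y≤1+q q≤x) (≤-reflexive (m+n∸n≡m 1 q)))
... | inj₂ y≤x = subst (_≤ 1) (sym (m≤n⇒∣n-m∣≡n∸m y≤x))
                   (≤-trans (∸-mono x≤1+q q≤y) (≤-reflexive (m+n∸n≡m 1 q)))

∑≡n*lower⇒constant : ∀ n (D : Fin n → ℕ) q → (∀ x → q ≤ D x) → ∑ n D ≡ n * q → ∀ x → D x ≡ q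
∑≡n*lower⇒constant n D q q≤D ∑≡n*q x with D x ≟ q
... | yes Dx≡q = Dx≡q
... | no  Dx≢q = contradiction (trans (∑-const n q) (sym ∑≡n*q))
                   (<⇒≢ (∑-mono-< n q≤D x (≤∧≢⇒< (q≤D x) (Dx≢q ∘ sym))))

module ℚᵘ-Sum = CommutativeMonoidSum ℚᵘ.+-0-commutativeMonoid

deviation : ∀ {n} .{{_ : NonZero n}} → (Fin n → ℕ) → ℕ → ℚ
deviation {n} D m = ∑ℚ n (λ x → ℚ.∣ ℕtoℚ (D x) ℚ.- (+ m ℚ./ n) ∣)

∑ℚ-cong : ∀ n {f g : Fin n → ℚ} → (∀ x → f x ≡ g x) → ∑ℚ n f ≡ ∑ℚ n g
∑ℚ-cong zero    f≗g = refl
∑ℚ-cong (suc n) f≗g = cong₂ ℚ._+_ (f≗g zero) (∑ℚ-cong n (f≗g ∘ suc))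

deviation-cong : ∀ {n} .{{_ : NonZero n}} {D D' : Fin n → ℕ} {m m'} →
                 (∀ x → D x ≡ D' x) → m ≡ m' → deviation D m ≡ deviation D' m'
deviation-cong {n} D≗D' refl = ∑ℚ-cong n (λ x → cong (λ d → ℚ.∣ ℕtoℚ d ℚ.- _ ∣) (D≗D' x))

toℚᵘ-/ : ∀ k n .{{_ : NonZero n}} → toℚᵘ (+ k ℚ./ n) ℚᵘ.≃ + k ℚᵘ./ n
toℚᵘ-/ k (suc n) = ℚ.toℚᵘ-fromℚᵘ (mkℚᵘ (+ k) n)

toℚᵘ-∑ℚ : ∀ n (f : Fin n → ℚ) → toℚᵘ (∑ℚ n f) ℚᵘ.≃ ℚᵘ-Sum.sum (toℚᵘ ∘ f)
toℚᵘ-∑ℚ zero    f = ℚᵘ.≃-refl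
toℚᵘ-∑ℚ (suc n) f = ℚᵘ.≃-trans (ℚ.toℚᵘ-homo-+ (f zero) (∑ℚ n (f ∘ suc)))
                               (ℚᵘ.+-congʳ (toℚᵘ (f zero)) (toℚᵘ-∑ℚ n (f ∘ suc)))

/-+ : ∀ x y n .{{_ : NonZero n}} → + x ℚᵘ./ n ℚᵘ.+ + y ℚᵘ./ n ℚᵘ.≃ + (x + y) ℚᵘ./ n
/-+ x y d@(suc _) = *≡* (begin
  (+ x ℤ.* + d ℤ.+ + y ℤ.* + d) ℤ.* + d
    ≡⟨ cong₂ (λ i j → (i ℤ.+ j) ℤ.* + d) (ℤ.pos-* x d) (ℤ.pos-* y d) ⟨
  (+ (x * d) ℤ.+ + (y * d)) ℤ.* + d
    ≡⟨ ℤ.pos-* (x * d + y * d) d ⟨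
  + ((x * d + y * d) * d)
    ≡⟨ cong +_ (solve 3 (λ x y d → (x :* d :+ y :* d) :* d := (x :+ y) :* (d :* d)) refl x y d) ⟩
  + ((x + y) * (d * d))
    ≡⟨ ℤ.pos-* (x + y) (d * d) ⟩
  + (x + y) ℤ.* + (d * d)
    ∎)
  where open ≡-Reasoning

∑-/ : ∀ m (k : Fin m → ℕ) n .{{_ : NonZero n}} →
      ℚᵘ-Sum.sum (λ i → + k i ℚᵘ./ n) ℚᵘ.≃ + ∑ m k ℚᵘ./ n
∑-/ zero    k (suc n) = *≡* refl
∑-/ (suc m) k n       = ℚᵘ.≃-trans (ℚᵘ.+-congʳ (+ k zero ℚᵘ./ n) (∑-/ m (k ∘ suc) n))
                                   (/-+ (k zero) (∑ m (k ∘ suc)) n)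

ℕtoℚ-mono-≤ : ∀ {m n} → m ≤ n → ℕtoℚ m ℚ.≤ ℕtoℚ n
ℕtoℚ-mono-≤ {m} {n} m≤n = ℚ.toℚᵘ-cancel-≤ (begin
  toℚᵘ (ℕtoℚ m)  ≃⟨ toℚᵘ-/ m 1 ⟩
  + m ℚᵘ./ 1     ≤⟨ *≤* (ℤ.*-monoʳ-≤-nonNeg (+ 1) (+≤+ m≤n)) ⟩
  + n ℚᵘ./ 1     ≃⟨ toℚᵘ-/ n 1 ⟨
  toℚᵘ (ℕtoℚ n)  ∎)
  where open ℚᵘ.≤-Reasoning

ℕtoℚ-homo-+ : ∀ m n → ℕtoℚ (m + n) ≡ ℕtoℚ m ℚ.+ ℕtoℚ n
ℕtoℚ-homo-+ m n = ℚ.toℚᵘ-injective (begin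
  toℚᵘ (ℕtoℚ (m + n))                ≈⟨ toℚᵘ-/ (m + n) 1 ⟩
  + (m + n) ℚᵘ./ 1                   ≈⟨ /-+ m n 1 ⟨
  + m ℚᵘ./ 1 ℚᵘ.+ + n ℚᵘ./ 1         ≈⟨ ℚᵘ.+-cong (toℚᵘ-/ m 1) (toℚᵘ-/ n 1) ⟨
  toℚᵘ (ℕtoℚ m) ℚᵘ.+ toℚᵘ (ℕtoℚ n)   ≈⟨ ℚ.toℚᵘ-homo-+ (ℕtoℚ m) (ℕtoℚ n) ⟨
  toℚᵘ (ℕtoℚ m ℚ.+ ℕtoℚ n)           ∎)
  where open ≈-Reasoning ℚᵘ.≃-setoid

ℕtoℚ-symDiff-triangle : ∀ {a b} (G H K : BipGraph a b) {p q : ℚ} →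
                        ℕtoℚ (symDiff G H) ℚ.≤ p → ℕtoℚ (symDiff H K) ℚ.≤ q →
                        ℕtoℚ (symDiff G K) ℚ.≤ p ℚ.+ q
ℕtoℚ-symDiff-triangle G H K {p} {q} GH≤p HK≤q = begin
  ℕtoℚ (symDiff G K)                          ≤⟨ ℕtoℚ-mono-≤ (symDiff-triangle G H K) ⟩
  ℕtoℚ (symDiff G H + symDiff H K)            ≡⟨ ℕtoℚ-homo-+ (symDiff G H) (symDiff H K) ⟩
  ℕtoℚ (symDiff G H) ℚ.+ ℕtoℚ (symDiff H K)   ≤⟨ ℚ.+-mono-≤ GH≤p HK≤q ⟩
  p ℚ.+ q                                     ∎
  where open ℚ.≤-Reasoning

∣⊖∣≡∣-∣ : ∀ m n → ℤ.∣ m ⊖ n ∣ ≡ ∣ m - n ∣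
∣⊖∣≡∣-∣ m n with ≤-total m n
... | inj₁ m≤n = trans (ℤ.∣⊖∣-≤ m≤n) (sym (m≤n⇒∣m-n∣≡n∸m m≤n))
... | inj₂ n≤m = trans (cong ℤ.∣_∣ (ℤ.⊖-≥ n≤m)) (sym (m≤n⇒∣n-m∣≡n∸m n≤m))

∣d-m/n∣≃∣n*d-m∣/n : ∀ d m n .{{_ : NonZero n}} →
                    ℚᵘ.∣ + d ℚᵘ./ 1 ℚᵘ.- + m ℚᵘ./ n ∣ ℚᵘ.≃ + ∣ n * d - m ∣ ℚᵘ./ n
∣d-m/n∣≃∣n*d-m∣/n d m n@(suc n-1) = *≡* (begin
  + ℤ.∣ + d ℤ.* + n ℤ.+ ℤ.- (+ m) ℤ.* + 1 ∣ ℤ.* + n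
    ≡⟨ cong (λ i → + ℤ.∣ i ∣ ℤ.* + n) numerator ⟩
  + ℤ.∣ (n * d) ⊖ m ∣ ℤ.* + n
    ≡⟨ cong (λ k → + k ℤ.* + n) (∣⊖∣≡∣-∣ (n * d) m) ⟩
  + ∣ n * d - m ∣ ℤ.* + n
    ≡⟨ cong (λ k → + ∣ n * d - m ∣ ℤ.* + suc k) (+-identityʳ n-1) ⟨
  + ∣ n * d - m ∣ ℤ.* + (1 * n)
    ∎)
  where
  open ≡-Reasoning
  numerator : + d ℤ.* + n ℤ.+ ℤ.- (+ m) ℤ.* + 1 ≡ (n * d) ⊖ m
  numerator = begin
    + d ℤ.* + n ℤ.+ ℤ.- (+ m) ℤ.* + 1  ≡⟨ cong₂ ℤ._+_ (sym (ℤ.pos-* d n)) (ℤ.*-identityʳ (ℤ.- + m)) ⟩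
    + (d * n) ℤ.+ ℤ.- (+ m)            ≡⟨ cong (λ k → + k ℤ.+ ℤ.- (+ m)) (*-comm d n) ⟩
    + (n * d) ℤ.- + m                  ≡⟨ ℤ.m-n≡m⊖n (n * d) m ⟩
    (n * d) ⊖ m                        ∎

toℚᵘ-∣d-m/n∣ : ∀ d m n .{{_ : NonZero n}} →
               toℚᵘ ℚ.∣ ℕtoℚ d ℚ.- + m ℚ./ n ∣ ℚᵘ.≃ + ∣ n * d - m ∣ ℚᵘ./ n
toℚᵘ-∣d-m/n∣ d m n = begin
  toℚᵘ ℚ.∣ ℕtoℚ d ℚ.- + m ℚ./ n ∣
    ≈⟨ ℚ.toℚᵘ-homo-∣-∣ (ℕtoℚ d ℚ.- + m ℚ./ n) ⟩
  ℚᵘ.∣ toℚᵘ (ℕtoℚ d ℚ.- + m ℚ./ n) ∣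
    ≈⟨ ℚᵘ.∣-∣-cong (ℚ.toℚᵘ-homo-+ (ℕtoℚ d) (ℚ.- (+ m ℚ./ n))) ⟩
  ℚᵘ.∣ toℚᵘ (ℕtoℚ d) ℚᵘ.+ toℚᵘ (ℚ.- (+ m ℚ./ n)) ∣
    ≈⟨ ℚᵘ.∣-∣-cong (ℚᵘ.+-cong (toℚᵘ-/ d 1) (ℚᵘ.≃-trans (ℚ.toℚᵘ-homo‿- (+ m ℚ./ n)) (ℚᵘ.-‿cong (toℚᵘ-/ m n)))) ⟩
  ℚᵘ.∣ + d ℚᵘ./ 1 ℚᵘ.- + m ℚᵘ./ n ∣
    ≈⟨ ∣d-m/n∣≃∣n*d-m∣/n d m n ⟩
  + ∣ n * d - m ∣ ℚᵘ./ n
    ∎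
  where open ≈-Reasoning ℚᵘ.≃-setoid

X/1≤K/n : ∀ {X K} n .{{_ : NonZero n}} → n * X ≤ K → + X ℚᵘ./ 1 ℚᵘ.≤ + K ℚᵘ./ n
X/1≤K/n {X} {K} n@(suc _) n*X≤K = *≤* (begin
  + X ℤ.* + n  ≡⟨ ℤ.pos-* X n ⟨
  + (X * n)    ≤⟨ +≤+ (≤-trans (≤-reflexive (*-comm X n)) n*X≤K) ⟩
  + K          ≡⟨ ℤ.*-identityʳ (+ K) ⟨
  + K ℤ.* + 1  ∎)
  where open ℤ.≤-Reasoning

n*X≤∑∣n*D-m∣⇒X≤deviation : ∀ {n} .{{_ : NonZero n}} (D : Fin n → ℕ) m X →
                           n * X ≤ ∑ n (λ x → ∣ n * D x - m ∣) → ℕtoℚ X ℚ.≤ deviation D m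
n*X≤∑∣n*D-m∣⇒X≤deviation {n} D m X n*X≤∑ = ℚ.toℚᵘ-cancel-≤ (begin
  toℚᵘ (ℕtoℚ X)                                           ≃⟨ toℚᵘ-/ X 1 ⟩
  + X ℚᵘ./ 1                                              ≤⟨ X/1≤K/n n n*X≤∑ ⟩
  + ∑ n k ℚᵘ./ n                                          ≃⟨ ∑-/ n k n ⟨
  ℚᵘ-Sum.sum (λ x → + k x ℚᵘ./ n)                         ≃⟨ ℚᵘ-Sum.sum-cong-≋ (λ x → toℚᵘ-∣d-m/n∣ (D x) m n) ⟨
  ℚᵘ-Sum.sum (λ x → toℚᵘ ℚ.∣ ℕtoℚ (D x) ℚ.- + m ℚ./ n ∣)  ≃⟨ toℚᵘ-∑ℚ n _ ⟨
  toℚᵘ (deviation D m)                                    ∎)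
  where
  open ℚᵘ.≤-Reasoning
  k : Fin n → ℕ
  k x = ∣ n * D x - m ∣

record Rebalancing {a b} (q : ℕ) (G : BipGraph a b) : Set where
  field
    graph          : BipGraph a b
    degB-preserved : ∀ v → degB graph v ≡ degB G v
    degA-within    : ∀ u → q ≤ degA graph u × degA graph u ≤ suc q
    symDiff-bound  : symDiff G graph ≤ 2 * imbalance q (degA G)

  edges-preserved : edges graph ≡ edges G
  edges-preserved = edges-cong graph G degB-preserved

  edges-transpose-preserved : edges (transpose graph) ≡ edges G
  edges-transpose-preserved = trans (sym (edges≡∑degB graph)) edges-preserved

  almostRegular : ∀ u u' → ∣ degA graph u - degA graph u' ∣ ≤ 1
  almostRegular u u' = within⇒∣-∣≤1 (degA-within u) (degA-within u')

  regular : a * q ≡ edges G → ∀ u u' → degA graph u ≡ degA graph u'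
  regular a*q≡m u u' = trans (degA≡q u) (sym (degA≡q u'))
    where
    degA≡q : ∀ u → degA graph u ≡ q
    degA≡q = ∑≡n*lower⇒constant a (degA graph) q (proj₁ ∘ degA-within)
                                  (trans edges-preserved (sym a*q≡m))

record RebalancingStep {a b} (q : ℕ) (G : BipGraph a b) : Set where
  field
    next           : BipGraph a b
    next-degB      : ∀ v → degB next v ≡ degB G v
    next-imbalance : imbalance q (degA next) < imbalance q (degA G)
    next-symDiff   : symDiff G next ≤ 2

rebalancing-step : ∀ {a b} q (G : BipGraph a b) → a * q ≤ edges G → edges G < a * suc q →
                   imbalance q (degA G) ≢ 0 → RebalancingStep q G
rebalancing-step q G lower upper Φ≢0
  with ∃-donor q (degA G) lower Φ≢0 | ∃-recipient q (degA G) upper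
... | u , q<Du , big-donor | u' , Du'≤q , small-recipient
  with degA<⇒private-neighbour G (≤-<-trans Du'≤q q<Du)
... | v , uv∈G , u'v∉G = record
  { next           = R
  ; next-degB      = degB-moveEdge G u≢u' uv∈G u'v∉G
  ; next-imbalance = imbalance-transfer-< q (degA G) (degA R)
                       (degA-moveEdge-source G u≢u' uv∈G u'v∉G)
                       (degA-moveEdge-target G u≢u' uv∈G u'v∉G)
                       (degA-moveEdge-other G u≢u' uv∈G u'v∉G)
                       q<Du Du'≤q big-donor small-recipient Φ≢0
  ; next-symDiff   = symDiff-moveEdge G u≢u' uv∈G u'v∉G
  }
  where
  R = moveEdge G u u' v
  u≢u' : u ≢ u'
  u≢u' refl = <-irrefl refl (≤-<-trans Du'≤q q<Du)

rebalance : ∀ {a b} q k (G : BipGraph a b) → imbalance q (degA G) ≤ k →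
            a * q ≤ edges G → edges G < a * suc q → Rebalancing q G
rebalance q k G Φ≤k lower upper with imbalance q (degA G) ≟ 0
... | yes Φ≡0 = record
  { graph          = G
  ; degB-preserved = λ _ → refl
  ; degA-within    = imbalance≡0⇒within q (degA G) Φ≡0
  ; symDiff-bound  = ≤-trans (≤-reflexive (symDiff-self G)) z≤n
  }
rebalance q zero    G Φ≤0   lower upper | no Φ≢0 = contradiction (n≤0⇒n≡0 Φ≤0) Φ≢0
rebalance {a} q (suc k) G Φ≤1+k lower upper | no Φ≢0 = record
  { graph          = graph
  ; degB-preserved = λ v → trans (degB-preserved v) (next-degB v)
  ; degA-within    = degA-within
  ; symDiff-bound  = begin
      symDiff G graph                      ≤⟨ symDiff-triangle G next graph ⟩
      symDiff G next + symDiff next graph  ≤⟨ +-mono-≤ next-symDiff symDiff-bound ⟩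
      2 + 2 * imbalance q (degA next)      ≡⟨ *-suc 2 _ ⟨
      2 * suc (imbalance q (degA next))    ≤⟨ *-monoʳ-≤ 2 next-imbalance ⟩
      2 * imbalance q (degA G)             ∎
  }
  where
  open ≤-Reasoning
  open RebalancingStep (rebalancing-step q G lower upper Φ≢0)
  edges-next : edges next ≡ edges G
  edges-next = edges-cong next G next-degB
  rest : Rebalancing q next
  rest = rebalance q k next (≤-pred (≤-trans next-imbalance Φ≤1+k))
                            (subst (a * q ≤_) (sym edges-next) lower)
                            (subst (_< a * suc q) (sym edges-next) upper)
  open Rebalancing rest

n*[m/n]≤m : ∀ m n .{{_ : NonZero n}} → n * (m / n) ≤ m
n*[m/n]≤m m n = subst (_≤ m) (*-comm (m / n) n) (m/n*n≤m m n)

m<n*[1+m/n] : ∀ m n .{{_ : NonZero n}} → m < n * suc (m / n)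
m<n*[1+m/n] m n = begin-strict
  m                  ≡⟨ m≡m%n+[m/n]*n m n ⟩
  m % n + m / n * n  <⟨ +-monoˡ-< (m / n * n) (m%n<n m n) ⟩
  n + m / n * n      ≡⟨ *-comm (suc (m / n)) n ⟩
  n * suc (m / n)    ∎
  where open ≤-Reasoning

balance : ∀ {a b} .{{_ : NonZero a}} (G : BipGraph a b) → Rebalancing (edges G / a) G
balance {a} G = rebalance (edges G / a) _ G ≤-refl (n*[m/n]≤m (edges G) a) (m<n*[1+m/n] (edges G) a)

balance-cost : ∀ {a b} .{{_ : NonZero a}} (G : BipGraph a b) (r : Rebalancing (edges G / a) G) →
               ℕtoℚ (symDiff G (Rebalancing.graph r)) ℚ.≤ deviation (degA G) (edges G)
balance-cost {a} G r = n*X≤∑∣n*D-m∣⇒X≤deviation (degA G) (edges G) _ (begin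
  a * symDiff G graph
    ≤⟨ *-monoʳ-≤ a symDiff-bound ⟩
  a * (2 * imbalance q (degA G))
    ≤⟨ n*[2*imbalance]≤∑∣n*D-∑D∣ q (degA G) (n*[m/n]≤m _ a) (<⇒≤ (m<n*[1+m/n] _ a)) ⟩
  ∑ a (λ u → ∣ a * degA G u - edges G ∣)
    ∎)
  where
  open ≤-Reasoning
  open Rebalancing r
  q = edges G / a

theorem2 : (a b : ℕ) .{{_ : NonZero a}} .{{_ : NonZero b}} (G : BipGraph a b) →
    Σ (BipGraph a b) (λ R →
      (edges R ≡ edges G)
      × AlmostRegular R
      × (ℕtoℚ (symDiff G R) ℚ.≤ s₂ G)
      × (a ∣ edges G → b ∣ edges G → Semiregular R))
theorem2 a b G = R , edges-R , (almostA , almostRegular r₂) , cost , semiregular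
  where
  open Rebalancing
  r₁ = balance G
  R₁ = graph r₁
  r₂ = balance (transpose R₁)
  R  = transpose (graph r₂)

  degA-R : ∀ u → degA R u ≡ degA R₁ u
  degA-R = degB-preserved r₂

  edges-R : edges R ≡ edges G
  edges-R = trans (∑-cong a degA-R) (edges-preserved r₁)

  almostA : ∀ u u' → ∣ degA R u - degA R u' ∣ ≤ 1
  almostA u u' rewrite degA-R u | degA-R u' = almostRegular r₁ u u'

  cost : ℕtoℚ (symDiff G R) ℚ.≤ s₂ G
  cost = ℕtoℚ-symDiff-triangle G R₁ R (balance-cost G r₁)
           (subst₂ ℚ._≤_ (cong ℕtoℚ (symDiff-transpose R₁ R))
                         (deviation-cong (degB-preserved r₁) (edges-transpose-preserved r₁))
                         (balance-cost (transpose R₁) r₂))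

  semiregular : a ∣ edges G → b ∣ edges G → Semiregular R
  semiregular a∣m b∣m =
    (λ u u' → trans (degA-R u) (trans (regular r₁ (m*[n/m]≡n a∣m) u u') (sym (degA-R u')))) ,
    regular r₂ (m*[n/m]≡n (subst (b ∣_) (sym (edges-transpose-preserved r₁)) b∣m))
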